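{- For all finite multisets $\Gamma,\Delta$ of formulas: the sequent $\Gamma\Rightarrow\Delta$ is derivable in $\mathsf{GWF}$ if and only if $\vdash_{\mathsf{WF}}\bigwedge\Gamma\rightarrow\bigvee\Delta$.
   Context: Formulas are built from a countable set of propositional atoms and the constant $\bot$ using $\wedge,\vee,\rightarrow$; $A\leftrightarrow B$ abbreviates $(A\rightarrow B)\wedge(B\rightarrow A)$. $\bigwedge\Gamma$ is the conjunction and $\bigvee\Delta$ the disjunction of the formulas in the multiset (an empty conjunction is read as $\bot\rightarrow\bot$, an empty disjunction as $\bot$). Sequent calculus $\mathsf{GWF}$ (sequents $\Gamma\Rightarrow\Delta$ with $\Gamma,\Delta$ finite multisets, $p$ atomic): (Ax) $p,\Gamma\Rightarrow\Delta,p$; ($\bot_L$) $\bot,\Gamma\Rightarrow\Delta$; ($\wedge_L$) from $A,B,\Gamma\Rightarrow\Delta$ infer $A\wedge B,\Gamma\Rightarrow\Delta$; ($\wedge_R$) from $\Gamma\Rightarrow\Delta,A$ and $\Gamma\Rightarrow\Delta,B$ infer $\Gamma\Rightarrow\Delta,A\wedge B$; ($\vee_L$) from $A,\Gamma\Rightarrow\Delta$ and $B,\Gamma\Rightarrow\Delta$ infer $A\vee B,\Gamma\Rightarrow\Delta$; ($\vee_R$) from $\Gamma\Rightarrow\Delta,A,B$ infer $\Gamma\Rightarrow\Delta,A\vee B$; ($\rightarrow_R$) from $A\Rightarrow B$ infer $\Gamma\Rightarrow A\rightarrow B,\Delta$; ($\rightarrow_{LR}$) from $A\Rightarrow B$,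 $B\Rightarrow A$, $C\Rightarrow D$, $D\Rightarrow C$ infer $\Gamma,A\rightarrow C\Rightarrow B\rightarrow D,\Delta$. Hilbert system $\mathsf{WF}$: axioms are all instances of $A\rightarrow(A\vee B)$; $B\rightarrow(A\vee B)$; $(A\wedge B)\rightarrow A$; $(A\wedge B)\rightarrow B$; $A\wedge(B\vee C)\rightarrow(A\wedge B)\vee(A\wedge C)$; $A\rightarrow A$; $\bot\rightarrow A$. Rules: from $A$ and $A\rightarrow B$ infer $B$; from $A$ infer $B\rightarrow A$; from $A\rightarrow B$ and $B\rightarrow C$ infer $A\rightarrow C$; from $A\rightarrow B$ and $A\rightarrow C$ infer $A\rightarrow(B\wedge C)$; from $A\rightarrow C$ and $B\rightarrow C$ infer $(A\vee B)\rightarrow C$; from $A$ and $B$ infer $A\wedge B$; from $A\leftrightarrow B$ and $C\leftrightarrow D$ infer $(A\rightarrow C)\leftrightarrow(B\rightarrow D)$. $\vdash_{\mathsf{WF}}A$ means $A$ is obtainable from axioms by finitely many rule applications. -}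

module Defs where

open import Data.Nat using (ℕ)
open import Data.List using (List; []; _∷_)
open import Data.List.Relation.Binary.Permutation.Propositional using (_↭_)

infixr 6 _∧'_
infixr 5 _∨'_
infixr 4 _⇒'_

data Formula : Set where
  atom : ℕ → Formula
  ⊥'   : Formula
  _∧'_ : Formula → Formula → Formula
  _∨'_ : Formula → Formula → Formula
  _⇒'_ : Formula → Formula → Formula

_⇔'_ : Formula → Formula → Formula
A ⇔' B = (A ⇒' B) ∧' (B ⇒' A)

⋀ : List Formula → Formula
⋀ [] = ⊥' ⇒' ⊥'
⋀ (A ∷ []) = A
⋀ (A ∷ B ∷ Γ) = A ∧' ⋀ (B ∷ Γ)

⋁ : List Formula → Formula
⋁ [] = ⊥'
⋁ (A ∷ []) = A
⋁ (A ∷ B ∷ Δ) = A ∨' ⋁ (B ∷ Δ)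

-- Sequent calculus GWF. Multisets are lists up to permutation: in each rule the
-- conclusion's antecedent/succedent is any permutation of the displayed multiset.
data GWF : List Formula → List Formula → Set where
  ax   : ∀ {Γ Δ Γc Δc} p → Γc ↭ (atom p ∷ Γ) → Δc ↭ (atom p ∷ Δ) → GWF Γc Δc
  ⊥L   : ∀ {Γ Δ Γc} → Γc ↭ (⊥' ∷ Γ) → GWF Γc Δ
  ∧L   : ∀ {A B Γ Δ Γc} → Γc ↭ ((A ∧' B) ∷ Γ) →
         GWF (A ∷ B ∷ Γ) Δ → GWF Γc Δ
  ∧R   : ∀ {A B Γ Δ Δc} → Δc ↭ ((A ∧' B) ∷ Δ) →
         GWF Γ (A ∷ Δ) → GWF Γ (B ∷ Δ) → GWF Γ Δc
  ∨L   : ∀ {A B Γ Δ Γc} → Γc ↭ ((A ∨' B) ∷ Γ) →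
         GWF (A ∷ Γ) Δ → GWF (B ∷ Γ) Δ → GWF Γc Δ
  ∨R   : ∀ {A B Γ Δ Δc} → Δc ↭ ((A ∨' B) ∷ Δ) →
         GWF Γ (A ∷ B ∷ Δ) → GWF Γ Δc
  ⇒R   : ∀ {A B Γ Δ Δc} → Δc ↭ ((A ⇒' B) ∷ Δ) →
         GWF (A ∷ []) (B ∷ []) → GWF Γ Δc
  ⇒LR  : ∀ {A B C D Γ Δ Γc Δc} → Γc ↭ ((A ⇒' C) ∷ Γ) → Δc ↭ ((B ⇒' D) ∷ Δ) →
         GWF (A ∷ []) (B ∷ []) → GWF (B ∷ []) (A ∷ []) →
         GWF (C ∷ []) (D ∷ []) → GWF (D ∷ []) (C ∷ []) → GWF Γc Δc

data ⊢WF : Formula → Set where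
  ax∨₁  : ∀ {A B} → ⊢WF (A ⇒' (A ∨' B))
  ax∨₂  : ∀ {A B} → ⊢WF (B ⇒' (A ∨' B))
  ax∧₁  : ∀ {A B} → ⊢WF ((A ∧' B) ⇒' A)
  ax∧₂  : ∀ {A B} → ⊢WF ((A ∧' B) ⇒' B)
  axDist : ∀ {A B C} → ⊢WF ((A ∧' (B ∨' C)) ⇒' ((A ∧' B) ∨' (A ∧' C)))
  axId  : ∀ {A} → ⊢WF (A ⇒' A)
  ax⊥   : ∀ {A} → ⊢WF (⊥' ⇒' A)
  mp    : ∀ {A B} → ⊢WF A → ⊢WF (A ⇒' B) → ⊢WF B
  weak  : ∀ {A B} → ⊢WF A → ⊢WF (B ⇒' A)
  trans : ∀ {A B C} → ⊢WF (A ⇒' B) → ⊢WF (B ⇒' C) → ⊢WF (A ⇒' C)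
  conjI : ∀ {A B C} → ⊢WF (A ⇒' B) → ⊢WF (A ⇒' C) → ⊢WF (A ⇒' (B ∧' C))
  disjE : ∀ {A B C} → ⊢WF (A ⇒' C) → ⊢WF (B ⇒' C) → ⊢WF ((A ∨' B) ⇒' C)
  adj   : ∀ {A B} → ⊢WF A → ⊢WF B → ⊢WF (A ∧' B)
  cong⇒ : ∀ {A B C D} → ⊢WF (A ⇔' B) → ⊢WF (C ⇔' D) →
          ⊢WF ((A ⇒' C) ⇔' (B ⇒' D))

{-# OPTIONS --safe #-}
-- Sequents are read as ⋀ Γ → ⋁ Δ, which is invariant under permuting Γ and Δ; soundness
-- then checks each rule of GWF in WF. Conversely every axiom and rule of WF is simulated
-- in GWF, where modus ponens and the transitivity rule need cut. Cut is admissible, by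
-- induction on the cut formula and then on the derivation in which it occurs on the right.
-- The rules for ∧ and ∨ are invertible, so those cut formulas reduce to their immediate
-- subformulas. Atoms and implications have no left rule of their own: their left occurrence
-- is followed through the other premise up to the axioms and ⇒LR steps in which it is
-- principal, and each of these is rebuilt from what the first premise provides: the same
-- atom in the antecedent, a derivation of X ⇒ Y by ⇒R, or an antecedent implication whose
-- components are interderivable with X and Y (composing these uses cut on X and Y).

module Submission where

open import Defs
open import Data.List using (List; []; _∷_; _++_; [_])
open import Data.List.Membership.Propositional using (_∈_)
open import Data.List.Membership.Propositional.Properties using (∈-∃++)
open import Data.List.Relation.Unary.Any using (here; there)
open import Data.List.Relation.Binary.Subset.Propositional using (_⊆_)
open import Data.List.Relation.Binary.Permutation.Propositional using (_↭_; ↭-refl; ↭-sym; ↭-trans; ↭-prep; ↭-swap)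
open import Data.List.Relation.Binary.Permutation.Propositional.Properties using (∈-resp-↭; shift; shifts; drop-∷; ++⁺ˡ; ++-comm; ↭-empty-inv; ↭-singleton-inv)
open import Data.Product using (_×_; _,_; proj₁; proj₂; ∃-syntax)
open import Data.Sum using (_⊎_; inj₁; inj₂)
open import Data.Unit using (⊤; tt)
open import Function using (_∘_)
open import Relation.Binary.PropositionalEquality using (_≡_; refl)

private variable
  A B C F X Y : Formula
  Γ Γ′ Γc Δ Δ′ Δc : List Formula

↭-swap₂ : ∀ {x y : Formula} {xs} → x ∷ y ∷ xs ↭ y ∷ x ∷ xs
↭-swap₂ = ↭-swap _ _ ↭-refl

↭-pull : ∀ Θ → Γ ↭ F ∷ Γ′ → Θ ++ Γ ↭ F ∷ Θ ++ Γ′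
↭-pull Θ p = ↭-trans (++⁺ˡ Θ p) (shift _ Θ _)

↭⇒∈ : Γ ↭ F ∷ Γ′ → F ∈ Γ
↭⇒∈ p = ∈-resp-↭ (↭-sym p) (here refl)

∈⇒↭ : F ∈ Γ → ∃[ Γ′ ] (Γ ↭ F ∷ Γ′)
∈⇒↭ {F} m with us , vs , refl ← ∈-∃++ m = us ++ vs , shift F us vs

compareHeads : Γc ↭ A ∷ Γ → Γc ↭ F ∷ Γ′ →
               (A ≡ F × Γ ↭ Γ′) ⊎ ∃[ Θ ] (Γ ↭ F ∷ Θ × Γ′ ↭ A ∷ Θ)
compareHeads p q with ∈-resp-↭ p (↭⇒∈ q)
... | here refl = inj₁ (refl , drop-∷ (↭-trans (↭-sym p) q))
... | there m with Θ , r ← ∈⇒↭ m =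
  inj₂ (Θ , r , drop-∷ (↭-trans (↭-sym q) (↭-trans p (↭-trans (↭-prep _ r) ↭-swap₂))))

-- Soundness

infixr 4 _⨾_
_⨾_ : ⊢WF (A ⇒' B) → ⊢WF (B ⇒' C) → ⊢WF (A ⇒' C)
_⨾_ = trans

∧-comm : ⊢WF ((A ∧' B) ⇒' (B ∧' A))
∧-comm = conjI ax∧₂ ax∧₁

∧-distribʳ-∨ : ⊢WF (((A ∨' B) ∧' C) ⇒' ((A ∧' C) ∨' (B ∧' C)))
∧-distribʳ-∨ = ∧-comm ⨾ axDist ⨾ disjE (∧-comm ⨾ ax∨₁) (∧-comm ⨾ ax∨₂)

∨-distribʳ-∧⁻ : ⊢WF (((A ∨' C) ∧' (B ∨' C)) ⇒' ((A ∧' B) ∨' C))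
∨-distribʳ-∧⁻ = ∧-distribʳ-∨ ⨾ disjE (axDist ⨾ disjE ax∨₁ (ax∧₂ ⨾ ax∨₂)) (ax∧₁ ⨾ ax∨₂)

⋀-proj₁ : ∀ Γ → ⊢WF (⋀ (A ∷ Γ) ⇒' A)
⋀-proj₁ []      = axId
⋀-proj₁ (_ ∷ _) = ax∧₁

⋀-proj₂ : ∀ Γ → ⊢WF (⋀ (A ∷ Γ) ⇒' ⋀ Γ)
⋀-proj₂ []      = weak axId
⋀-proj₂ (_ ∷ _) = ax∧₂

⋀-∷-intro : ∀ Γ → ⊢WF (C ⇒' A) → ⊢WF (C ⇒' ⋀ Γ) → ⊢WF (C ⇒' ⋀ (A ∷ Γ))
⋀-∷-intro []      d _ = d
⋀-∷-intro (_ ∷ _) d e = conjI d e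

⋁-inj₁ : ∀ Δ → ⊢WF (A ⇒' ⋁ (A ∷ Δ))
⋁-inj₁ []      = axId
⋁-inj₁ (_ ∷ _) = ax∨₁

⋁-inj₂ : ∀ Δ → ⊢WF (⋁ Δ ⇒' ⋁ (A ∷ Δ))
⋁-inj₂ []      = ax⊥
⋁-inj₂ (_ ∷ _) = ax∨₂

⋁-∷-elim : ∀ Δ → ⊢WF (A ⇒' C) → ⊢WF (⋁ Δ ⇒' C) → ⊢WF (⋁ (A ∷ Δ) ⇒' C)
⋁-∷-elim []      d _ = d
⋁-∷-elim (_ ∷ _) d e = disjE d e

⋀-elim : A ∈ Γ → ⊢WF (⋀ Γ ⇒' A)
⋀-elim (here {xs = Γ} refl) = ⋀-proj₁ Γ
⋀-elim (there {xs = Γ} m)   = ⋀-proj₂ Γ ⨾ ⋀-elim m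

⋁-intro : A ∈ Δ → ⊢WF (A ⇒' ⋁ Δ)
⋁-intro (here {xs = Δ} refl) = ⋁-inj₁ Δ
⋁-intro (there {xs = Δ} m)   = ⋁-intro m ⨾ ⋁-inj₂ Δ

⋀-⊆ : ∀ Γ → Γ ⊆ Γ′ → ⊢WF (⋀ Γ′ ⇒' ⋀ Γ)
⋀-⊆ []      _ = weak axId
⋀-⊆ (_ ∷ Γ) s = ⋀-∷-intro Γ (⋀-elim (s (here refl))) (⋀-⊆ Γ (s ∘ there))

⋁-⊆ : ∀ Δ → Δ ⊆ Δ′ → ⊢WF (⋁ Δ ⇒' ⋁ Δ′)
⋁-⊆ []      _ = ax⊥
⋁-⊆ (_ ∷ Δ) s = ⋁-∷-elim Δ (⋁-intro (s (here refl))) (⋁-⊆ Δ (s ∘ there))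

⋀-uncons : ∀ {Γ} → Γc ↭ A ∷ Γ → ⊢WF (⋀ Γc ⇒' (A ∧' ⋀ Γ))
⋀-uncons {Γ = Γ} p = ⋀-⊆ (_ ∷ Γ) (∈-resp-↭ (↭-sym p)) ⨾ conjI (⋀-proj₁ Γ) (⋀-proj₂ Γ)

⋁-cons : ∀ {Δ} → Δc ↭ A ∷ Δ → ⊢WF ((A ∨' ⋁ Δ) ⇒' ⋁ Δc)
⋁-cons {Δ = Δ} p = disjE (⋁-inj₁ Δ) (⋁-inj₂ Δ) ⨾ ⋁-⊆ (_ ∷ Δ) (∈-resp-↭ (↭-sym p))

sound : GWF Γ Δ → ⊢WF (⋀ Γ ⇒' ⋁ Δ)
sound (ax p a b)               = ⋀-elim (↭⇒∈ a) ⨾ ⋁-intro (↭⇒∈ b)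
sound (⊥L a)                   = ⋀-elim (↭⇒∈ a) ⨾ ax⊥
sound (∧L {_} {B} {Γ} a D)     =
  ⋀-uncons a ⨾ ⋀-∷-intro (B ∷ Γ) (ax∧₁ ⨾ ax∧₁) (⋀-∷-intro Γ (ax∧₁ ⨾ ax∧₂) ax∧₂) ⨾ sound D
sound (∧R {Δ = Δ} a D E)       =
  conjI (sound D ⨾ ⋁-∷-elim Δ ax∨₁ ax∨₂) (sound E ⨾ ⋁-∷-elim Δ ax∨₁ ax∨₂)
    ⨾ ∨-distribʳ-∧⁻ ⨾ ⋁-cons a
sound (∨L {Γ = Γ} a D E)       =
  ⋀-uncons a ⨾ ∧-distribʳ-∨
    ⨾ disjE (⋀-∷-intro Γ ax∧₁ ax∧₂ ⨾ sound D) (⋀-∷-intro Γ ax∧₁ ax∧₂ ⨾ sound E)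
sound (∨R {_} {B} {Δ = Δ} a D) =
  sound D ⨾ ⋁-∷-elim (B ∷ Δ) (ax∨₁ ⨾ ax∨₁) (⋁-∷-elim Δ (ax∨₂ ⨾ ax∨₁) ax∨₂) ⨾ ⋁-cons a
sound (⇒R a D)                 = weak (sound D) ⨾ ⋁-intro (↭⇒∈ a)
sound (⇒LR a b D₁ D₂ D₃ D₄)   =
  ⋀-elim (↭⇒∈ a)
    ⨾ mp (cong⇒ (adj (sound D₁) (sound D₂)) (adj (sound D₃) (sound D₄))) ax∧₁
    ⨾ ⋁-intro (↭⇒∈ b)

-- Structural properties of GWF

permute : Γ ↭ Γ′ → Δ ↭ Δ′ → GWF Γ Δ → GWF Γ′ Δ′
permute g d (ax p a b)             = ax p (↭-trans (↭-sym g) a) (↭-trans (↭-sym d) b)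
permute g d (⊥L a)                 = ⊥L (↭-trans (↭-sym g) a)
permute g d (∧L a D)               = ∧L (↭-trans (↭-sym g) a) (permute ↭-refl d D)
permute g d (∧R a D E)             = ∧R (↭-trans (↭-sym d) a) (permute g ↭-refl D) (permute g ↭-refl E)
permute g d (∨L a D E)             = ∨L (↭-trans (↭-sym g) a) (permute ↭-refl d D) (permute ↭-refl d E)
permute g d (∨R a D)               = ∨R (↭-trans (↭-sym d) a) (permute g ↭-refl D)
permute g d (⇒R a D)               = ⇒R (↭-trans (↭-sym d) a) D
permute g d (⇒LR a b D₁ D₂ D₃ D₄) = ⇒LR (↭-trans (↭-sym g) a) (↭-trans (↭-sym d) b) D₁ D₂ D₃ D₄

permuteˡ : Γ ↭ Γ′ → GWF Γ Δ → GWF Γ′ Δ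
permuteˡ g = permute g ↭-refl

permuteʳ : Δ ↭ Δ′ → GWF Γ Δ → GWF Γ Δ′
permuteʳ = permute ↭-refl

weakenˡ : ∀ Θ → GWF Γ Δ → GWF (Θ ++ Γ) Δ
weakenˡ Θ (ax p a b)             = ax p (↭-pull Θ a) b
weakenˡ Θ (⊥L a)                 = ⊥L (↭-pull Θ a)
weakenˡ Θ (∧L {A} {B} a D)       = ∧L (↭-pull Θ a) (permuteˡ (shifts Θ (A ∷ B ∷ [])) (weakenˡ Θ D))
weakenˡ Θ (∧R a D E)             = ∧R a (weakenˡ Θ D) (weakenˡ Θ E)
weakenˡ Θ (∨L {A} {B} a D E)     =
  ∨L (↭-pull Θ a) (permuteˡ (shifts Θ [ A ]) (weakenˡ Θ D)) (permuteˡ (shifts Θ [ B ]) (weakenˡ Θ E))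
weakenˡ Θ (∨R a D)               = ∨R a (weakenˡ Θ D)
weakenˡ Θ (⇒R a D)               = ⇒R a D
weakenˡ Θ (⇒LR a b D₁ D₂ D₃ D₄) = ⇒LR (↭-pull Θ a) b D₁ D₂ D₃ D₄

weakenʳ : ∀ Θ → GWF Γ Δ → GWF Γ (Θ ++ Δ)
weakenʳ Θ (ax p a b)             = ax p a (↭-pull Θ b)
weakenʳ Θ (⊥L a)                 = ⊥L a
weakenʳ Θ (∧L a D)               = ∧L a (weakenʳ Θ D)
weakenʳ Θ (∧R {A} {B} a D E)     =
  ∧R (↭-pull Θ a) (permuteʳ (shifts Θ [ A ]) (weakenʳ Θ D)) (permuteʳ (shifts Θ [ B ]) (weakenʳ Θ E))
weakenʳ Θ (∨L a D E)             = ∨L a (weakenʳ Θ D) (weakenʳ Θ E)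
weakenʳ Θ (∨R {A} {B} a D)       = ∨R (↭-pull Θ a) (permuteʳ (shifts Θ (A ∷ B ∷ [])) (weakenʳ Θ D))
weakenʳ Θ (⇒R a D)               = ⇒R (↭-pull Θ a) D
weakenʳ Θ (⇒LR a b D₁ D₂ D₃ D₄) = ⇒LR a (↭-pull Θ b) D₁ D₂ D₃ D₄

∧L-inv : Γc ↭ (A ∧' B) ∷ Γ → GWF Γc Δ → GWF (A ∷ B ∷ Γ) Δ
∧L-inv e (ax p a b) with compareHeads e a
... | inj₁ (() , _)
... | inj₂ (_ , q , _) = ax p (↭-pull (_ ∷ _ ∷ []) q) b
∧L-inv e (⊥L a) with compareHeads e a
... | inj₁ (() , _)
... | inj₂ (_ , q , _) = ⊥L (↭-pull (_ ∷ _ ∷ []) q)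
∧L-inv e (∧L {R} {S} a D) with compareHeads e a
... | inj₁ (refl , q) = permuteˡ (↭-prep _ (↭-prep _ (↭-sym q))) D
... | inj₂ (_ , q₁ , q₂) =
  ∧L (↭-pull (_ ∷ _ ∷ []) q₁)
     (permuteˡ (shifts (_ ∷ _ ∷ []) (R ∷ S ∷ [])) (∧L-inv (↭-pull (R ∷ S ∷ []) q₂) D))
∧L-inv e (∨L {R} a D E) with compareHeads e a
... | inj₁ (() , _)
... | inj₂ (_ , q₁ , q₂) =
  ∨L (↭-pull (_ ∷ _ ∷ []) q₁) (permuteˡ (shift _ (_ ∷ _ ∷ []) _) (∧L-inv (↭-pull [ _ ] q₂) D))
                              (permuteˡ (shift _ (_ ∷ _ ∷ []) _) (∧L-inv (↭-pull [ _ ] q₂) E))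
∧L-inv e (∧R a D E) = ∧R a (∧L-inv e D) (∧L-inv e E)
∧L-inv e (∨R a D) = ∨R a (∧L-inv e D)
∧L-inv e (⇒R a D) = ⇒R a D
∧L-inv e (⇒LR a b D₁ D₂ D₃ D₄) with compareHeads e a
... | inj₁ (() , _)
... | inj₂ (_ , q , _) = ⇒LR (↭-pull (_ ∷ _ ∷ []) q) b D₁ D₂ D₃ D₄

∨L-inv : Γc ↭ (A ∨' B) ∷ Γ → GWF Γc Δ → GWF (A ∷ Γ) Δ × GWF (B ∷ Γ) Δ
∨L-inv e (ax p a b) with compareHeads e a
... | inj₁ (() , _)
... | inj₂ (_ , q , _) = ax p (↭-pull [ _ ] q) b , ax p (↭-pull [ _ ] q) b
∨L-inv e (⊥L a) with compareHeads e a
... | inj₁ (() , _)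
... | inj₂ (_ , q , _) = ⊥L (↭-pull [ _ ] q) , ⊥L (↭-pull [ _ ] q)
∨L-inv e (∧L {R} {S} a D) with compareHeads e a
... | inj₁ (() , _)
... | inj₂ (_ , q₁ , q₂) with ∨L-inv (↭-pull (R ∷ S ∷ []) q₂) D
...   | D₁ , D₂ = ∧L (↭-pull [ _ ] q₁) (permuteˡ (↭-sym (shift _ (R ∷ S ∷ []) _)) D₁)
                , ∧L (↭-pull [ _ ] q₁) (permuteˡ (↭-sym (shift _ (R ∷ S ∷ []) _)) D₂)
∨L-inv e (∨L a D E) with compareHeads e a
... | inj₁ (refl , q) = permuteˡ (↭-prep _ (↭-sym q)) D , permuteˡ (↭-prep _ (↭-sym q)) E
... | inj₂ (_ , q₁ , q₂) with ∨L-inv (↭-pull [ _ ] q₂) D | ∨L-inv (↭-pull [ _ ] q₂) E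
...   | D₁ , D₂ | E₁ , E₂ = ∨L (↭-pull [ _ ] q₁) (permuteˡ ↭-swap₂ D₁) (permuteˡ ↭-swap₂ E₁)
                          , ∨L (↭-pull [ _ ] q₁) (permuteˡ ↭-swap₂ D₂) (permuteˡ ↭-swap₂ E₂)
∨L-inv e (∧R a D E) with ∨L-inv e D | ∨L-inv e E
... | D₁ , D₂ | E₁ , E₂ = ∧R a D₁ E₁ , ∧R a D₂ E₂
∨L-inv e (∨R a D) with ∨L-inv e D
... | D₁ , D₂ = ∨R a D₁ , ∨R a D₂
∨L-inv e (⇒R a D) = ⇒R a D , ⇒R a D
∨L-inv e (⇒LR a b D₁ D₂ D₃ D₄) with compareHeads e a
... | inj₁ (() , _)
... | inj₂ (_ , q , _) = ⇒LR (↭-pull [ _ ] q) b D₁ D₂ D₃ D₄ , ⇒LR (↭-pull [ _ ] q) b D₁ D₂ D₃ D₄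

∧R-inv : Δc ↭ (A ∧' B) ∷ Δ → GWF Γ Δc → GWF Γ (A ∷ Δ) × GWF Γ (B ∷ Δ)
∧R-inv e (ax p a b) with compareHeads e b
... | inj₁ (() , _)
... | inj₂ (_ , q , _) = ax p a (↭-pull [ _ ] q) , ax p a (↭-pull [ _ ] q)
∧R-inv e (⊥L a) = ⊥L a , ⊥L a
∧R-inv e (∧L a D) with ∧R-inv e D
... | D₁ , D₂ = ∧L a D₁ , ∧L a D₂
∧R-inv e (∨L a D E) with ∧R-inv e D | ∧R-inv e E
... | D₁ , D₂ | E₁ , E₂ = ∨L a D₁ E₁ , ∨L a D₂ E₂
∧R-inv e (∧R a D E) with compareHeads e a
... | inj₁ (refl , q) = permuteʳ (↭-prep _ (↭-sym q)) D , permuteʳ (↭-prep _ (↭-sym q)) E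
... | inj₂ (_ , q₁ , q₂) with ∧R-inv (↭-pull [ _ ] q₂) D | ∧R-inv (↭-pull [ _ ] q₂) E
...   | D₁ , D₂ | E₁ , E₂ = ∧R (↭-pull [ _ ] q₁) (permuteʳ ↭-swap₂ D₁) (permuteʳ ↭-swap₂ E₁)
                          , ∧R (↭-pull [ _ ] q₁) (permuteʳ ↭-swap₂ D₂) (permuteʳ ↭-swap₂ E₂)
∧R-inv e (∨R {R} {S} a D) with compareHeads e a
... | inj₁ (() , _)
... | inj₂ (_ , q₁ , q₂) with ∧R-inv (↭-pull (R ∷ S ∷ []) q₂) D
...   | D₁ , D₂ = ∨R (↭-pull [ _ ] q₁) (permuteʳ (↭-sym (shift _ (R ∷ S ∷ []) _)) D₁)
                , ∨R (↭-pull [ _ ] q₁) (permuteʳ (↭-sym (shift _ (R ∷ S ∷ []) _)) D₂)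
∧R-inv e (⇒R a D) with compareHeads e a
... | inj₁ (() , _)
... | inj₂ (_ , q , _) = ⇒R (↭-pull [ _ ] q) D , ⇒R (↭-pull [ _ ] q) D
∧R-inv e (⇒LR a b D₁ D₂ D₃ D₄) with compareHeads e b
... | inj₁ (() , _)
... | inj₂ (_ , q , _) = ⇒LR a (↭-pull [ _ ] q) D₁ D₂ D₃ D₄ , ⇒LR a (↭-pull [ _ ] q) D₁ D₂ D₃ D₄

∨R-inv : Δc ↭ (A ∨' B) ∷ Δ → GWF Γ Δc → GWF Γ (A ∷ B ∷ Δ)
∨R-inv e (ax p a b) with compareHeads e b
... | inj₁ (() , _)
... | inj₂ (_ , q , _) = ax p a (↭-pull (_ ∷ _ ∷ []) q)
∨R-inv e (⊥L a) = ⊥L a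
∨R-inv e (∧L a D) = ∧L a (∨R-inv e D)
∨R-inv e (∨L a D E) = ∨L a (∨R-inv e D) (∨R-inv e E)
∨R-inv e (∧R a D E) with compareHeads e a
... | inj₁ (() , _)
... | inj₂ (_ , q₁ , q₂) =
  ∧R (↭-pull (_ ∷ _ ∷ []) q₁) (permuteʳ (shift _ (_ ∷ _ ∷ []) _) (∨R-inv (↭-pull [ _ ] q₂) D))
                              (permuteʳ (shift _ (_ ∷ _ ∷ []) _) (∨R-inv (↭-pull [ _ ] q₂) E))
∨R-inv e (∨R {R} {S} a D) with compareHeads e a
... | inj₁ (refl , q) = permuteʳ (↭-prep _ (↭-prep _ (↭-sym q))) D
... | inj₂ (_ , q₁ , q₂) =
  ∨R (↭-pull (_ ∷ _ ∷ []) q₁)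
     (permuteʳ (shifts (_ ∷ _ ∷ []) (R ∷ S ∷ [])) (∨R-inv (↭-pull (R ∷ S ∷ []) q₂) D))
∨R-inv e (⇒R a D) with compareHeads e a
... | inj₁ (() , _)
... | inj₂ (_ , q , _) = ⇒R (↭-pull (_ ∷ _ ∷ []) q) D
∨R-inv e (⇒LR a b D₁ D₂ D₃ D₄) with compareHeads e b
... | inj₁ (() , _)
... | inj₂ (_ , q , _) = ⇒LR a (↭-pull (_ ∷ _ ∷ []) q) D₁ D₂ D₃ D₄

-- Cut admissibility

CutFor : Formula → Set
CutFor A = ∀ {Γ Δ} → GWF Γ (A ∷ Δ) → GWF (A ∷ Γ) Δ → GWF Γ Δ

compose : CutFor A → GWF Γ [ A ] → GWF [ A ] Δ → GWF Γ Δ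
compose {Γ = Γ} {Δ = Δ} cut d e =
  cut (permuteʳ (++-comm Δ _) (weakenʳ Δ d)) (permuteˡ (++-comm Γ _) (weakenˡ Γ e))

_≃_ : Formula → Formula → Set
A ≃ B = GWF [ A ] [ B ] × GWF [ B ] [ A ]

≃-trans : CutFor B → A ≃ B → B ≃ C → A ≃ C
≃-trans cut (ab , ba) (bc , cb) = compose cut ab bc , compose cut cb ba

-- An inert formula in the antecedent is principal only in ax or in ⇒LR; Closes A Δ
-- records the succedent formula it is matched against there.
data Inert : Formula → Set where
  atom : ∀ p → Inert (atom p)
  _⇒_  : ∀ X Y → Inert (X ⇒' Y)

data Closes : Formula → List Formula → Set where
  byAx  : ∀ {p Δ Δc} → Δc ↭ atom p ∷ Δ → Closes (atom p) Δc
  by⇒LR : ∀ {X Y B D Δ Δc} → Δc ↭ (B ⇒' D) ∷ Δ → X ≃ B → Y ≃ D → Closes (X ⇒' Y) Δc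

Replaces : List Formula → Formula → Set
Replaces Γ A = ∀ {Δ} → Closes A Δ → GWF Γ Δ

eliminateˡ : Inert A → Replaces Γ A → Γc ↭ A ∷ Γ → GWF Γc Δ → GWF Γ Δ
eliminateˡ i r e (ax p a b) with compareHeads e a
... | inj₁ (refl , _) = r (byAx b)
... | inj₂ (_ , q , _) = ax p q b
eliminateˡ i r e (⊥L a) with compareHeads e a
eliminateˡ () r e (⊥L a) | inj₁ (refl , _)
... | inj₂ (_ , q , _) = ⊥L q
eliminateˡ i r e (∧L a D) with compareHeads e a
eliminateˡ () r e (∧L a D) | inj₁ (refl , _)
... | inj₂ (_ , q₁ , q₂) = ∧L q₁ (eliminateˡ i (∧L-inv q₁ ∘ r) (↭-pull (_ ∷ _ ∷ []) q₂) D)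
eliminateˡ i r e (∨L a D E) with compareHeads e a
eliminateˡ () r e (∨L a D E) | inj₁ (refl , _)
... | inj₂ (_ , q₁ , q₂) = ∨L q₁ (eliminateˡ i (proj₁ ∘ ∨L-inv q₁ ∘ r) (↭-pull [ _ ] q₂) D)
                                 (eliminateˡ i (proj₂ ∘ ∨L-inv q₁ ∘ r) (↭-pull [ _ ] q₂) E)
eliminateˡ i r e (∧R a D E) = ∧R a (eliminateˡ i r e D) (eliminateˡ i r e E)
eliminateˡ i r e (∨R a D) = ∨R a (eliminateˡ i r e D)
eliminateˡ i r e (⇒R a D) = ⇒R a D
eliminateˡ i r e (⇒LR a b D₁ D₂ D₃ D₄) with compareHeads e a
... | inj₁ (refl , _) = r (by⇒LR b (D₁ , D₂) (D₃ , D₄))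
... | inj₂ (_ , q , _) = ⇒LR q b D₁ D₂ D₃ D₄

ax-replaces : ∀ {p} → Γ ↭ atom p ∷ Γ′ → Replaces Γ (atom p)
ax-replaces a (byAx b) = ax _ a b

⇒R-replaces : CutFor X → CutFor Y → GWF [ X ] [ Y ] → Replaces Γ (X ⇒' Y)
⇒R-replaces cutX cutY d (by⇒LR b (_ , bx) (yd , _)) = ⇒R b (compose cutX bx (compose cutY d yd))

⇒LR-replaces : ∀ {P R} → CutFor X → CutFor Y → Γ ↭ (P ⇒' R) ∷ Γ′ → P ≃ X → R ≃ Y →
               Replaces Γ (X ⇒' Y)
⇒LR-replaces cutX cutY a px ry (by⇒LR b xb yd)
  with pb , bp ← ≃-trans cutX px xb | rd , dr ← ≃-trans cutY ry yd = ⇒LR a b pb bp rd dr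

cut-∧ : CutFor X → CutFor Y → GWF Γ (X ∷ Δ) → GWF Γ (Y ∷ Δ) → GWF ((X ∧' Y) ∷ Γ) Δ → GWF Γ Δ
cut-∧ cutX cutY D₁ D₂ E =
  cutX D₁ (cutY (weakenˡ [ _ ] D₂) (permuteˡ ↭-swap₂ (∧L-inv ↭-refl E)))

cut-∨ : CutFor X → CutFor Y → GWF Γ (X ∷ Y ∷ Δ) → GWF ((X ∨' Y) ∷ Γ) Δ → GWF Γ Δ
cut-∨ cutX cutY D E with E₁ , E₂ ← ∨L-inv ↭-refl E = cutY (cutX D (weakenʳ [ _ ] E₁)) E₂

SubformulaCuts : Formula → Set
SubformulaCuts (X ∧' Y) = CutFor X × CutFor Y
SubformulaCuts (X ∨' Y) = CutFor X × CutFor Y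
SubformulaCuts (X ⇒' Y) = CutFor X × CutFor Y
SubformulaCuts _        = ⊤

cutWith : SubformulaCuts A → Δc ↭ A ∷ Δ → GWF Γ Δc → GWF (A ∷ Γ) Δ → GWF Γ Δ
cutWith ih e (ax p a b) E with compareHeads e b
... | inj₁ (refl , _) = eliminateˡ (atom p) (ax-replaces a) ↭-refl E
... | inj₂ (_ , q , _) = ax p a q
cutWith ih e (⊥L a) E = ⊥L a
cutWith ih e (∧L a D) E =
  ∧L a (cutWith ih e D (permuteˡ (shift _ (_ ∷ _ ∷ []) _) (∧L-inv (↭-pull [ _ ] a) E)))
cutWith ih e (∨L a D₁ D₂) E with E₁ , E₂ ← ∨L-inv (↭-pull [ _ ] a) E =
  ∨L a (cutWith ih e D₁ (permuteˡ ↭-swap₂ E₁)) (cutWith ih e D₂ (permuteˡ ↭-swap₂ E₂))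
cutWith ih e (∧R a D₁ D₂) E with compareHeads e a
... | inj₁ (refl , q) =
  cut-∧ (proj₁ ih) (proj₂ ih) (permuteʳ (↭-prep _ (↭-sym q)) D₁) (permuteʳ (↭-prep _ (↭-sym q)) D₂)
        E
... | inj₂ (_ , q₁ , q₂) with E₁ , E₂ ← ∧R-inv q₁ E =
  ∧R q₁ (cutWith ih (↭-pull [ _ ] q₂) D₁ E₁) (cutWith ih (↭-pull [ _ ] q₂) D₂ E₂)
cutWith ih e (∨R a D) E with compareHeads e a
... | inj₁ (refl , q) = cut-∨ (proj₁ ih) (proj₂ ih) (permuteʳ (↭-prep _ (↭-prep _ (↭-sym q))) D) E
... | inj₂ (_ , q₁ , q₂) = ∨R q₁ (cutWith ih (↭-pull (_ ∷ _ ∷ []) q₂) D (∨R-inv q₁ E))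
cutWith ih e (⇒R a D) E with compareHeads e a
... | inj₁ (refl , _) = eliminateˡ (_ ⇒ _) (⇒R-replaces (proj₁ ih) (proj₂ ih) D) ↭-refl E
... | inj₂ (_ , q , _) = ⇒R q D
cutWith ih e (⇒LR a b D₁ D₂ D₃ D₄) E with compareHeads e b
... | inj₁ (refl , _) =
  eliminateˡ (_ ⇒ _) (⇒LR-replaces (proj₁ ih) (proj₂ ih) a (D₁ , D₂) (D₃ , D₄)) ↭-refl E
... | inj₂ (_ , q , _) = ⇒LR a q D₁ D₂ D₃ D₄

cut : ∀ A → CutFor A
subformulaCuts : ∀ A → SubformulaCuts A

cut A D E = cutWith (subformulaCuts A) ↭-refl D E

subformulaCuts (atom _) = tt
subformulaCuts ⊥'       = tt
subformulaCuts (X ∧' Y) = cut X , cut Y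
subformulaCuts (X ∨' Y) = cut X , cut Y
subformulaCuts (X ⇒' Y) = cut X , cut Y

-- Completeness

identity : ∀ A → GWF (A ∷ Γ) (A ∷ Δ)
identity (atom p) = ax p ↭-refl ↭-refl
identity ⊥'       = ⊥L ↭-refl
identity (X ∧' Y) = ∧L ↭-refl (∧R ↭-refl (identity X) (permuteˡ ↭-swap₂ (identity Y)))
identity (X ∨' Y) = ∨L ↭-refl (∨R ↭-refl (identity X)) (∨R ↭-refl (permuteʳ ↭-swap₂ (identity Y)))
identity (X ⇒' Y) = ⇒LR ↭-refl ↭-refl (identity X) (identity X) (identity Y) (identity Y)

⇒R-inv : GWF [] [ A ⇒' B ] → GWF [ A ] [ B ]
⇒R-inv (ax _ a _)        with () ← ↭-empty-inv (↭-sym a)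
⇒R-inv (⊥L a)            with () ← ↭-empty-inv (↭-sym a)
⇒R-inv (∧L a _)          with () ← ↭-empty-inv (↭-sym a)
⇒R-inv (∨L a _ _)        with () ← ↭-empty-inv (↭-sym a)
⇒R-inv (⇒LR a _ _ _ _ _) with () ← ↭-empty-inv (↭-sym a)
⇒R-inv (∧R a _ _)        with () ← ↭-singleton-inv (↭-sym a)
⇒R-inv (∨R a _)          with () ← ↭-singleton-inv (↭-sym a)
⇒R-inv (⇒R a D)          with refl ← ↭-singleton-inv (↭-sym a) = D

⇔-inv : GWF [] [ A ⇔' B ] → A ≃ B
⇔-inv d with ab , ba ← ∧R-inv ↭-refl d = ⇒R-inv ab , ⇒R-inv ba

⇔-intro : A ≃ B → GWF Γ [ A ⇔' B ]
⇔-intro (ab , ba) = ∧R ↭-refl (⇒R ↭-refl ab) (⇒R ↭-refl ba)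

⇒-cong : A ≃ B → X ≃ Y → (A ⇒' X) ≃ (B ⇒' Y)
⇒-cong (ab , ba) (xy , yx) = ⇒LR ↭-refl ↭-refl ab ba xy yx , ⇒LR ↭-refl ↭-refl ba ab yx xy

⊢WF⇒GWF : ⊢WF C → GWF [] [ C ]
⊢WF⇒GWF (ax∨₁ {A})         = ⇒R ↭-refl (∨R ↭-refl (identity A))
⊢WF⇒GWF (ax∨₂ {_} {B})     = ⇒R ↭-refl (∨R ↭-refl (permuteʳ ↭-swap₂ (identity B)))
⊢WF⇒GWF (ax∧₁ {A})         = ⇒R ↭-refl (∧L ↭-refl (identity A))
⊢WF⇒GWF (ax∧₂ {_} {B})     = ⇒R ↭-refl (∧L ↭-refl (permuteˡ ↭-swap₂ (identity B)))
⊢WF⇒GWF (axDist {A} {B} {C}) =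
  ⇒R ↭-refl (∧L ↭-refl (∨L ↭-swap₂
    (∨R ↭-refl (∧R ↭-refl (permuteˡ ↭-swap₂ (identity A)) (identity B)))
    (∨R ↭-refl (permuteʳ ↭-swap₂ (∧R ↭-refl (permuteˡ ↭-swap₂ (identity A)) (identity C))))))
⊢WF⇒GWF (axId {A})         = ⇒R ↭-refl (identity A)
⊢WF⇒GWF ax⊥                = ⇒R ↭-refl (⊥L ↭-refl)
⊢WF⇒GWF (mp {A} d e)       = compose (cut A) (⊢WF⇒GWF d) (⇒R-inv (⊢WF⇒GWF e))
⊢WF⇒GWF (weak {_} {B} d)   = ⇒R ↭-refl (weakenˡ [ B ] (⊢WF⇒GWF d))
⊢WF⇒GWF (trans {_} {B} d e) =
  ⇒R ↭-refl (compose (cut B) (⇒R-inv (⊢WF⇒GWF d)) (⇒R-inv (⊢WF⇒GWF e)))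
⊢WF⇒GWF (conjI d e)        = ⇒R ↭-refl (∧R ↭-refl (⇒R-inv (⊢WF⇒GWF d)) (⇒R-inv (⊢WF⇒GWF e)))
⊢WF⇒GWF (disjE d e)        = ⇒R ↭-refl (∨L ↭-refl (⇒R-inv (⊢WF⇒GWF d)) (⇒R-inv (⊢WF⇒GWF e)))
⊢WF⇒GWF (adj d e)          = ∧R ↭-refl (⊢WF⇒GWF d) (⊢WF⇒GWF e)
⊢WF⇒GWF (cong⇒ d e)        = ⇔-intro (⇒-cong (⇔-inv (⊢WF⇒GWF d)) (⇔-inv (⊢WF⇒GWF e)))

⋀-right : ∀ Γ → GWF Γ [ ⋀ Γ ]
⋀-right []          = ⇒R ↭-refl (⊥L ↭-refl)
⋀-right (A ∷ [])    = identity A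
⋀-right (A ∷ B ∷ Γ) = ∧R ↭-refl (identity A) (weakenˡ [ A ] (⋀-right (B ∷ Γ)))

⋁-left : ∀ Δ → GWF [ ⋁ Δ ] Δ
⋁-left []          = ⊥L ↭-refl
⋁-left (A ∷ [])    = identity A
⋁-left (A ∷ B ∷ Δ) = ∨L ↭-refl (identity A) (weakenʳ [ A ] (⋁-left (B ∷ Δ)))

complete : ⊢WF (⋀ Γ ⇒' ⋁ Δ) → GWF Γ Δ
complete {Γ} {Δ} d =
  compose (cut (⋁ Δ)) (compose (cut (⋀ Γ)) (⋀-right Γ) (⇒R-inv (⊢WF⇒GWF d))) (⋁-left Δ)

mainTheorem4 : (Γ Δ : List Formula) →
    (GWF Γ Δ → ⊢WF (⋀ Γ ⇒' ⋁ Δ)) × (⊢WF (⋀ Γ ⇒' ⋁ Δ) → GWF Γ Δ)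
mainTheorem4 Γ Δ = sound , complete
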